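{- In the nondeterministic Outcome Logic instance described in the context, for any program $C$ (satisfying the standing assumptions) and atomic assertions $P,Q$: \[\not\vDash\{P\}C\{Q\}\quad\text{iff}\quad\exists\varphi.\ \varphi\Rightarrow P,\ \mathsf{sat}(\varphi),\ \text{and}\ \vDash\langle\varphi\rangle C\langle\overline{Q}\oplus\top\rangle.\]
   Context: Nondeterministic instance: powerset monad with $\mathsf{bind}(S,k)=\bigcup_{x\in S}k(x)$, $\mathsf{unit}(x)=\{x\}$, monoid $\cup$, unit $\emptyset$. Programs $C::=\mathbf 0\mid\mathbf 1\mid C_1;C_2\mid C_1+C_2\mid C^\star\mid c$ over states $\Sigma$ have denotations $[\![C]\!]:\Sigma\to2^\Sigma$ ($\mathbf0\mapsto\emptyset$, $\mathbf 1\mapsto\{\sigma\}$, sequencing by Kleisli composition, $+$ by union, $C^\star$ as least fixed point of $f\mapsto\lambda\sigma.f^\dagger([\![C]\!](\sigma))\cup\{\sigma\}$), with $[\![C]\!]^\dagger(S)=\bigcup_{\sigma\in S}[\![C]\!](\sigma)$. Atomic assertions $\mathsf{Prop}$ with $\vDash_\Sigma\subseteq\Sigma\times\mathsf{Prop}$, closed under negation $\overline Q$ ($\sigma\vDash_\Sigma\overline Q$ iff $\sigma\not\vDash_\Sigma Q$). Outcome assertions $\varphi::=\top\mid\bot\mid\top^\oplus\mid\varphi\land\psi\mid\varphi\oplus\psi\mid\varphi\Rightarrow\psi\mid P$ over sets $S$: $\top^\oplus$ iff $S=\emptyset$; $S\vDash\varphi\oplus\psi$ iff $S=S_1\cup S_2$,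 $S_1\vDash\varphi$, $S_2\vDash\psi$; $\Rightarrow$ classical; $S\vDash P$ iff $S\ne\emptyset$ and all elements satisfy $P$. $\varphi\Rightarrow P$ means every set satisfying $\varphi$ satisfies $P$; $\mathsf{sat}(\varphi)$ means some set satisfies it. Hoare triple: $\vDash\{P\}C\{Q\}$ iff for all $\sigma\vDash_\Sigma P$ and $\tau\in[\![C]\!](\sigma)$, $\tau\vDash_\Sigma Q$. Outcome triple $\vDash\langle\varphi\rangle C\langle\psi\rangle$ iff $S\vDash\varphi$ implies $[\![C]\!]^\dagger(S)\vDash\psi$. Standing assumptions: (i) every iteration $D^\star$ in $C$ terminates after finitely many unrollings on each input set; (ii) atomic commands admit trace extrapolation: whenever $[\![c]\!]^\dagger(S)\vDash\psi$ with $\psi$ free of $\Rightarrow$, there is a $\Rightarrow$-free $\varphi$ with $S\vDash\varphi$ and $\vDash\langle\varphi\rangle c\langle\psi\rangle$. -}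

module Defs where

open import Level using (0ℓ)
open import Data.Nat using (ℕ; zero; suc; _≤_)
open import Data.Empty using (⊥)
open import Data.Unit using (⊤)
open import Data.Product using (Σ; ∃; _×_; _,_)
open import Data.Sum using (_⊎_)
open import Relation.Nullary using (¬_)
open import Relation.Binary.PropositionalEquality using (_≡_)
open import Relation.Binary.Construct.Closure.ReflexiveTransitive using (Star)
open import Function.Bundles using (_⇔_)

record OLInstance : Set₁ where
  field
    State   : Set
    Atom    : Set
    _⊨Σ_    : State → Atom → Set
    neg     : Atom → Atom
    neg-sem : ∀ σ Q → (σ ⊨Σ neg Q) ⇔ (¬ (σ ⊨Σ Q))
    Act     : Set
    ⟦_⟧ₐ    : Act → State → State → Set  -- τ ∈ ⟦c⟧(σ)  as  ⟦ c ⟧ₐ σ τ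

module Sem (I : OLInstance) where
  open OLInstance I public

  PSet : Set₁
  PSet = State → Set

  infixr 5 _⨟_
  infixr 4 _⊕ᶜ_
  data Cmd : Set where
    𝟘 𝟙   : Cmd
    _⨟_   : Cmd → Cmd → Cmd
    _⊕ᶜ_  : Cmd → Cmd → Cmd
    _⋆    : Cmd → Cmd
    atom  : Act → Cmd

  -- Denotation ⟦C⟧ : Σ → 2^Σ, written as a relation: ⟦ C ⟧ σ τ  iff  τ ∈ ⟦C⟧(σ).
  -- C⋆ is the least fixed point of f ↦ λσ. f†(⟦C⟧σ) ∪ {σ}, i.e. the
  -- inductively generated reflexive–transitive closure of ⟦C⟧.
  ⟦_⟧ : Cmd → State → State → Set
  ⟦ 𝟘 ⟧ σ τ = ⊥
  ⟦ 𝟙 ⟧ σ τ = σ ≡ τ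
  ⟦ C₁ ⨟ C₂ ⟧ σ τ = ∃ λ σ' → ⟦ C₁ ⟧ σ σ' × ⟦ C₂ ⟧ σ' τ
  ⟦ C₁ ⊕ᶜ C₂ ⟧ σ τ = ⟦ C₁ ⟧ σ τ ⊎ ⟦ C₂ ⟧ σ τ
  ⟦ C ⋆ ⟧ = Star ⟦ C ⟧
  ⟦ atom c ⟧ = ⟦ c ⟧ₐ

  _† : (State → State → Set) → PSet → PSet
  (R †) S τ = ∃ λ σ → S σ × R σ τ

  infixr 6 _∧ᵒ_
  infixr 5 _⊕ᵒ_
  infixr 4 _⇒ᵒ_
  data Assn : Set where
    ⊤ᵒ ⊥ᵒ ⊤⊕ : Assn
    _∧ᵒ_ _⊕ᵒ_ _⇒ᵒ_ : Assn → Assn → Assn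
    ⌜_⌝ : Atom → Assn

  _⊨_ : PSet → Assn → Set₁
  S ⊨ ⊤ᵒ = Level.Lift _ ⊤
  S ⊨ ⊥ᵒ = Level.Lift _ ⊥
  S ⊨ ⊤⊕ = Level.Lift _ (∀ σ → ¬ S σ)
  S ⊨ (φ ∧ᵒ ψ) = (S ⊨ φ) × (S ⊨ ψ)
  S ⊨ (φ ⊕ᵒ ψ) = Σ PSet λ S₁ → Σ PSet λ S₂ →
                   (∀ σ → S σ ⇔ (S₁ σ ⊎ S₂ σ)) × (S₁ ⊨ φ) × (S₂ ⊨ ψ)
  S ⊨ (φ ⇒ᵒ ψ) = S ⊨ φ → S ⊨ ψ
  S ⊨ ⌜ P ⌝ = Level.Lift _ ((∃ λ σ → S σ) × (∀ σ → S σ → σ ⊨Σ P))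

  _Entails_ : Assn → Atom → Set₁
  φ Entails P = ∀ S → S ⊨ φ → S ⊨ ⌜ P ⌝

  sat : Assn → Set₁
  sat φ = Σ PSet λ S → S ⊨ φ

  HoareValid : Atom → Cmd → Atom → Set
  HoareValid P C Q = ∀ σ τ → σ ⊨Σ P → ⟦ C ⟧ σ τ → τ ⊨Σ Q

  OTValid : Assn → Cmd → Assn → Set₁
  OTValid φ C ψ = ∀ S → S ⊨ φ → (⟦ C ⟧ †) S ⊨ ψ

  ImpFree : Assn → Set
  ImpFree ⊤ᵒ = ⊤
  ImpFree ⊥ᵒ = ⊤
  ImpFree ⊤⊕ = ⊤
  ImpFree (φ ∧ᵒ ψ) = ImpFree φ × ImpFree ψ
  ImpFree (φ ⊕ᵒ ψ) = ImpFree φ × ImpFree ψ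
  ImpFree (φ ⇒ᵒ ψ) = ⊥
  ImpFree ⌜ P ⌝ = ⊤

  -- Standing assumption (ii): trace extrapolation for atomic commands.
  TraceExtrapolation : Set₁
  TraceExtrapolation = ∀ (c : Act) (S : PSet) (ψ : Assn) → ImpFree ψ →
    (⟦ atom c ⟧ †) S ⊨ ψ →
    Σ Assn λ φ → ImpFree φ × S ⊨ φ × OTValid φ (atom c) ψ

  pow : ℕ → Cmd → PSet → PSet
  pow zero D S = S
  pow (suc n) D S = (⟦ D ⟧ †) (pow n D S)

  -- D⋆ terminates after finitely many unrollings on input set S:
  -- ⟦D⋆⟧†(S) = ⋃_{k ≤ n} (⟦D⟧†)^k(S) for some n (⊇ always holds).
  FinitelyUnrolls : Cmd → Set₁
  FinitelyUnrolls D = ∀ (S : PSet) → ∃ λ (n : ℕ) →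
    ∀ τ → (⟦ D ⋆ ⟧ †) S τ → ∃ λ k → k ≤ n × pow k D S τ

  -- Standing assumption (i): every iteration occurring in C terminates.
  LoopsTerminate : Cmd → Set₁
  LoopsTerminate 𝟘 = Level.Lift _ ⊤
  LoopsTerminate 𝟙 = Level.Lift _ ⊤
  LoopsTerminate (C₁ ⨟ C₂) = LoopsTerminate C₁ × LoopsTerminate C₂
  LoopsTerminate (C₁ ⊕ᶜ C₂) = LoopsTerminate C₁ × LoopsTerminate C₂
  LoopsTerminate (D ⋆) = FinitelyUnrolls D × LoopsTerminate D
  LoopsTerminate (atom c) = Level.Lift _ ⊤

-- A Hoare triple fails exactly when some run σ → τ starts in P and ends outside Q.
-- Along such a run, trace extrapolation for atomic commands lifts to whole programs:
-- by induction on the derivation of the run one builds a ⇒-free φ with {σ} ⊨ φ and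
-- ⟨φ⟩ C ⟨ψ ⊕ ⊤⟩ whenever {τ} ⊨ ψ.  The assertion ψ ⊕ ⊤ says that some subset of the
-- outcomes satisfies ψ; it is upward closed, which is what makes sequencing and
-- iteration compose.  Conjoining φ with P then gives the outcome-logic witness, and
-- conversely any outcome in Q̄ reached from P refutes the Hoare triple.
module Submission where

open import Defs
open import Level using (0ℓ; lift; lower)
open import Data.Product using (Σ; _×_; _,_; proj₁; proj₂)
open import Data.Sum using (inj₁; inj₂; [_,_]′)
open import Data.Unit using (tt)
open import Relation.Nullary using (¬_; Dec)
open import Relation.Nullary.Decidable using (map′; decidable-stable)
open import Relation.Unary using (_⊆_; ｛_｝)
open import Relation.Binary.Core using (_⇒_)
open import Relation.Binary.PropositionalEquality using (refl)
open import Relation.Binary.Construct.Closure.ReflexiveTransitive using (ε; _◅_)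
open import Function using (_∘_; id)
open import Function.Bundles using (_⇔_; mk⇔; Equivalence)
open import Axiom.ExcludedMiddle using (ExcludedMiddle)

module OutcomeLogic (I : OLInstance) where
  open Sem I

  possibly : Assn → Assn
  possibly ψ = ψ ⊕ᵒ ⊤ᵒ

  possibly-intro : ∀ {X ψ} → X ⊨ ψ → X ⊨ possibly ψ
  possibly-intro h = _ , _ , (λ _ → mk⇔ inj₁ [ id , id ]′) , h , lift tt

  possibly-part : ∀ {X ψ} → X ⊨ possibly ψ → Σ PSet λ X₁ → X₁ ⊆ X × X₁ ⊨ ψ
  possibly-part (X₁ , _ , X≐ , h , _) = X₁ , (λ x → Equivalence.from (X≐ _) (inj₁ x)) , h

  possibly-mono : ∀ {X Y ψ} → X ⊆ Y → X ⊨ possibly ψ → Y ⊨ possibly ψ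
  possibly-mono {ψ = ψ} X⊆Y h =
    let X₁ , X₁⊆X , h₁ = possibly-part {ψ = ψ} h
    in X₁ , _ , (λ _ → mk⇔ inj₂ [ X⊆Y ∘ X₁⊆X , id ]′) , h₁ , lift tt

  skip-possibly : ∀ {ψ} → OTValid (possibly ψ) 𝟙 (possibly ψ)
  skip-possibly S h = possibly-mono (λ {σ} Sσ → σ , Sσ , refl) h

  seq-possibly : ∀ {φ χ ψ} C₁ C₂ → OTValid φ C₁ (possibly χ) → OTValid χ C₂ (possibly ψ) →
                 OTValid φ (C₁ ⨟ C₂) (possibly ψ)
  seq-possibly _ _ v₁ v₂ S hS =
    let X₁ , X₁⊆ , hχ = possibly-part (v₁ S hS)
    in possibly-mono (λ (τ , X₁τ , r₂) → let σ , Sσ , r₁ = X₁⊆ X₁τ in σ , Sσ , τ , r₁ , r₂)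
                     (v₂ X₁ hχ)

  widen-possibly : ∀ {φ ψ} C D → ⟦ C ⟧ ⇒ ⟦ D ⟧ →
                   OTValid φ C (possibly ψ) → OTValid φ D (possibly ψ)
  widen-possibly _ _ C⇒D v S hS = possibly-mono (λ (σ , Sσ , r) → σ , Sσ , C⇒D r) (v S hS)

  Extrapolates : Cmd → State → Assn → Set₁
  Extrapolates C σ ψ = Σ Assn λ φ → ImpFree φ × ｛ σ ｝ ⊨ φ × OTValid φ C (possibly ψ)

  extrapolate-skip : ∀ {σ ψ} → ImpFree ψ → ｛ σ ｝ ⊨ ψ → Extrapolates 𝟙 σ ψ
  extrapolate-skip ifψ hσ = possibly _ , (ifψ , tt) , possibly-intro hσ , skip-possibly

  extrapolate-seq : ∀ C₁ C₂ {σ σ′ ψ} →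
    (∀ {χ} → ImpFree χ → ｛ σ′ ｝ ⊨ χ → Extrapolates C₁ σ χ) →
    Extrapolates C₂ σ′ ψ → Extrapolates (C₁ ⨟ C₂) σ ψ
  extrapolate-seq C₁ C₂ ext₁ (φ₂ , if₂ , hσ′ , v₂) =
    let φ₁ , if₁ , hσ , v₁ = ext₁ if₂ hσ′ in φ₁ , if₁ , hσ , seq-possibly C₁ C₂ v₁ v₂

  widen-extrapolates : ∀ C D {σ ψ} → ⟦ C ⟧ ⇒ ⟦ D ⟧ → Extrapolates C σ ψ → Extrapolates D σ ψ
  widen-extrapolates C D C⇒D (φ , ifφ , hσ , v) = φ , ifφ , hσ , widen-possibly C D C⇒D v

  -- Runs of D ⋆ are finite Star derivations.
  extrapolate : TraceExtrapolation → ∀ C {σ τ ψ} →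
                ImpFree ψ → ⟦ C ⟧ σ τ → ｛ τ ｝ ⊨ ψ → Extrapolates C σ ψ
  extrapolate TE 𝟙 ifψ refl hτ = extrapolate-skip ifψ hτ
  extrapolate TE (C₁ ⨟ C₂) ifψ (_ , r₁ , r₂) hτ =
    extrapolate-seq C₁ C₂ (λ ifχ → extrapolate TE C₁ ifχ r₁) (extrapolate TE C₂ ifψ r₂ hτ)
  extrapolate TE (C₁ ⊕ᶜ C₂) ifψ (inj₁ r) hτ =
    widen-extrapolates C₁ (C₁ ⊕ᶜ C₂) inj₁ (extrapolate TE C₁ ifψ r hτ)
  extrapolate TE (C₁ ⊕ᶜ C₂) ifψ (inj₂ r) hτ =
    widen-extrapolates C₂ (C₁ ⊕ᶜ C₂) inj₂ (extrapolate TE C₂ ifψ r hτ)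
  extrapolate TE (D ⋆) ifψ ε hτ =
    widen-extrapolates 𝟙 (D ⋆) (λ { refl → ε }) (extrapolate-skip ifψ hτ)
  extrapolate TE (D ⋆) ifψ (r ◅ rs) hτ =
    widen-extrapolates (D ⨟ D ⋆) (D ⋆) (λ (_ , r′ , rs′) → r′ ◅ rs′)
      (extrapolate-seq D (D ⋆) (λ ifχ → extrapolate TE D ifχ r) (extrapolate TE (D ⋆) ifψ rs hτ))
  extrapolate TE (atom c) {σ} ifψ r hτ =
    TE c ｛ σ ｝ (possibly _) (ifψ , tt)
       (possibly-mono (λ { refl → σ , refl , r }) (possibly-intro hτ))

  singleton-⊨ : ∀ {σ P} → σ ⊨Σ P → ｛ σ ｝ ⊨ ⌜ P ⌝
  singleton-⊨ {σ} p = lift ((σ , refl) , λ { _ refl → p })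

  HoareCounterexample : Atom → Cmd → Atom → Set
  HoareCounterexample P C Q = Σ State λ σ → Σ State λ τ → σ ⊨Σ P × ⟦ C ⟧ σ τ × ¬ τ ⊨Σ Q

  OutcomeRefutation : Atom → Cmd → Atom → Set₁
  OutcomeRefutation P C Q = Σ Assn λ φ → (φ Entails P) × sat φ × OTValid φ C (possibly ⌜ neg Q ⌝)

  ¬HoareValid⇒counterexample : ExcludedMiddle (Level.suc 0ℓ) → ∀ {P C Q} →
                               ¬ HoareValid P C Q → HoareCounterexample P C Q
  ¬HoareValid⇒counterexample em ¬valid =
    decidable-stable dec λ none →
      ¬valid λ σ τ p r → decidable-stable dec λ ¬q → none (σ , τ , p , r , ¬q)
    where
    dec : {A : Set} → Dec A
    dec = map′ lower lift em

  counterexample⇒¬HoareValid : ∀ {P C Q} → HoareCounterexample P C Q → ¬ HoareValid P C Q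
  counterexample⇒¬HoareValid (σ , τ , p , r , ¬q) valid = ¬q (valid σ τ p r)

  counterexample⇒refutation : TraceExtrapolation → ∀ {P} C {Q} →
                              HoareCounterexample P C Q → OutcomeRefutation P C Q
  counterexample⇒refutation TE C {Q} (σ , τ , p , r , ¬q) =
    let φ , _ , hσ , v = extrapolate TE C {ψ = ⌜ neg Q ⌝} tt r
                           (singleton-⊨ (Equivalence.from (neg-sem τ Q) ¬q))
    in φ ∧ᵒ ⌜ _ ⌝ , (λ _ → proj₂) , (｛ σ ｝ , hσ , singleton-⊨ p) , λ S → v S ∘ proj₁

  refutation⇒counterexample : ∀ {P} C {Q} → OutcomeRefutation P C Q → HoareCounterexample P C Q
  refutation⇒counterexample C {Q} (_ , ent , (S , hS) , v) =
    let X₁ , X₁⊆ , lift ((τ , X₁τ) , X₁⊨Q̄) = possibly-part {ψ = ⌜ neg Q ⌝} (v S hS)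
        σ , Sσ , r = X₁⊆ X₁τ
    in σ , τ , proj₂ (lower (ent S hS)) σ Sσ , r , Equivalence.to (neg-sem τ Q) (X₁⊨Q̄ τ X₁τ)

corollary5p7 : ExcludedMiddle (Level.suc 0ℓ) → (I : OLInstance) →
    let open Sem I in
    TraceExtrapolation → (C : Cmd) → LoopsTerminate C → (P Q : Atom) →
    (¬ HoareValid P C Q) ⇔ (Σ Assn λ φ → (φ Entails P) × sat φ × OTValid φ C (⌜ neg Q ⌝ ⊕ᵒ ⊤ᵒ))
corollary5p7 em I TE C _ P Q =
  mk⇔ (counterexample⇒refutation TE C ∘ ¬HoareValid⇒counterexample em {C = C})
      (counterexample⇒¬HoareValid {C = C} ∘ refutation⇒counterexample C)
  where open OutcomeLogic I
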